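{- Let $G$ be a finite simple undirected connected graph. Then for all distinct $a,b\in V(G)$, every minimal $a$-$b$ edge separator of $G$ induces a matching if and only if $G$ is a tree.
   Context: An $a$-$b$ edge separator is a set $E'\subseteq E(G)$ such that in the graph $G\setminus E'$ (vertex set $V(G)$, edge set $E(G)\setminus E'$) the vertices $a$ and $b$ lie in distinct connected components; it is minimal if no proper subset of $E'$ is an $a$-$b$ edge separator. A set of edges induces a matching if no two of its edges share a common vertex. -}

module Defs where

open import Data.Nat using (ℕ; zero; suc)
open import Data.Fin using (Fin; zero; suc; inject₁; fromℕ)
open import Data.Bool using (Bool; true; false; _∧_; not)
open import Data.Product using (Σ; _×_; ∃; _,_)
open import Relation.Binary.PropositionalEquality using (_≡_)
open import Relation.Nullary using (¬_)
open import Function.Definitions using (Injective)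

record SimpleGraph (n : ℕ) : Set where
  field
    adj    : Fin n → Fin n → Bool
    sym    : ∀ u v → adj u v ≡ adj v u
    irrefl : ∀ v → adj v v ≡ false
open SimpleGraph public

Rel₂ : ℕ → Set
Rel₂ n = Fin n → Fin n → Bool

data Reach {n : ℕ} (E : Rel₂ n) : Fin n → Fin n → Set where
  here : ∀ {u} → Reach E u u
  step : ∀ {u v w} → E u v ≡ true → Reach E v w → Reach E u w

IsEdgeSet : ∀ {n} → SimpleGraph n → Rel₂ n → Set
IsEdgeSet {n} G F = (∀ u v → F u v ≡ F v u) × (∀ u v → F u v ≡ true → adj G u v ≡ true)

_⊆ₑ_ : ∀ {n} → Rel₂ n → Rel₂ n → Set
F ⊆ₑ F' = ∀ u v → F u v ≡ true → F' u v ≡ true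

_⊂ₑ_ : ∀ {n} → Rel₂ n → Rel₂ n → Set
F ⊂ₑ F' = F ⊆ₑ F' × ∃ λ u → ∃ λ v → F' u v ≡ true × F u v ≡ false

deleteEdges : ∀ {n} → SimpleGraph n → Rel₂ n → Rel₂ n
deleteEdges G F u v = adj G u v ∧ not (F u v)

Connected : ∀ {n} → SimpleGraph n → Set
Connected {n} G = ∀ (u v : Fin n) → Reach (adj G) u v

IsSeparator : ∀ {n} → SimpleGraph n → Fin n → Fin n → Rel₂ n → Set
IsSeparator G a b F = IsEdgeSet G F × ¬ Reach (deleteEdges G F) a b

IsMinimalSeparator : ∀ {n} → SimpleGraph n → Fin n → Fin n → Rel₂ n → Set
IsMinimalSeparator {n} G a b F =
  IsSeparator G a b F × (∀ (F' : Rel₂ n) → IsEdgeSet G F' → F' ⊂ₑ F → ¬ IsSeparator G a b F')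

InducesMatching : ∀ {n} → Rel₂ n → Set
InducesMatching {n} F = ∀ (u v w : Fin n) → F u v ≡ true → F u w ≡ true → v ≡ w

record Cycle {n : ℕ} (G : SimpleGraph n) : Set where
  field
    k     : ℕ
    c     : Fin (suc (suc (suc k))) → Fin n
    inj   : Injective _≡_ _≡_ c
    path  : ∀ (i : Fin (suc (suc k))) → adj G (c (inject₁ i)) (c (suc i)) ≡ true
    close : adj G (c (fromℕ (suc (suc k)))) (c zero) ≡ true

Acyclic : ∀ {n} → SimpleGraph n → Set
Acyclic G = ¬ Cycle G

IsTree : ∀ {n} → SimpleGraph n → Set
IsTree G = Connected G × Acyclic G

-- If a vertex u carried two edges uv, uw of a minimal a-b separator F, minimality would force v and w
-- into the component of G ∖ F not containing u (each edge of F joins the two sides), and a path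
-- from v to w in that component together with u would be a cycle; so trees have only matching
-- minimal separators. Conversely, on a cycle x, y, …, z let K be the component of y in G − x: the
-- edges between K and its complement form a minimal x-y separator (every vertex of K still reaches y,
-- every other vertex still reaches x), and it contains both xy and xz because the rest of the cycle
-- joins y to z avoiding x. Both arguments end in a contradiction, so reachability may be assumed
-- decidable (under a double negation), which is how K becomes a Boolean vertex set.
module Submission where

open import Defs
open import Data.Nat using (ℕ; zero; suc)
open import Data.Fin using (Fin; zero; suc; inject₁; fromℕ; _≟_)
open import Data.Fin.Properties using (0≢1+n; suc-injective)
open import Data.Fin.Induction using (>-weakInduction)
open import Data.Bool using (Bool; true; false; _∧_; not; _xor_)
open import Data.Bool.Properties using (∧-zeroʳ; ∧-identityʳ; xor-comm; xor-same; not-¬)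
open import Data.Product using (Σ; _×_; _,_; proj₁; proj₂)
open import Data.Sum using (_⊎_; inj₁; inj₂)
open import Data.Empty using (⊥-elim)
open import Data.List using (List; []; _∷_; length; lookup)
open import Data.List.Relation.Unary.All as All using (All; []; _∷_)
open import Data.List.Relation.Unary.All.Properties using (¬Any⇒All¬)
open import Data.List.Relation.Unary.Any using (here; there)
open import Data.List.Relation.Unary.AllPairs using ([]; _∷_)
open import Data.List.Relation.Unary.Unique.Propositional using (Unique)
open import Data.List.Membership.Propositional using (_∈_)
open import Data.List.Membership.Propositional.Properties using (∈-lookup)
open import Function.Base using (_∘_)
open import Function.Bundles using (_⇔_; mk⇔; Equivalence)
open import Function.Definitions using (Injective)
open import Relation.Binary.PropositionalEquality using (_≡_; refl; trans; cong₂; subst; _≢_)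
import Relation.Binary.PropositionalEquality as ≡
open import Relation.Nullary using (¬_; Dec; yes; no; does; _×-dec_; _⊎-dec_)
open import Relation.Nullary.Decidable using (dec-true; dec-false; does-⇔; ¬¬-excluded-middle)
open import Relation.Unary using (Decidable)

∧-true⁻ : ∀ {x y} → x ∧ y ≡ true → x ≡ true × y ≡ true
∧-true⁻ {true} {true} refl = refl , refl

not-true⁻ : ∀ {x} → not x ≡ true → x ≡ false
not-true⁻ {false} refl = refl

∧-not-false⁻ : ∀ {x y} → y ≡ false → x ∧ not y ≡ false → x ≡ false
∧-not-false⁻ {x} refl h = trans (≡.sym (∧-identityʳ x)) h

xor≡false⇒≡ : ∀ {x y} → x xor y ≡ false → x ≡ y
xor≡false⇒≡ {false} {false} _ = refl
xor≡false⇒≡ {true} {true} _ = refl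

does-true⁻ : ∀ {P : Set} (P? : Dec P) → does P? ≡ true → P
does-true⁻ (yes p) _ = p

true⇒true-contra : ∀ {x y} → (x ≡ true → y ≡ true) → y ≡ false → x ≡ false
true⇒true-contra {false} _ _ = refl
true⇒true-contra {true} x⇒y y≡false = ⊥-elim (not-¬ (x⇒y refl) y≡false)

lookup-injective : ∀ {A : Set} {xs : List A} → Unique xs → Injective _≡_ _≡_ (lookup xs)
lookup-injective (_ ∷ _) {zero} {zero} _ = refl
lookup-injective (x∉ ∷ _) {zero} {suc j} eq = ⊥-elim (All.lookup x∉ (∈-lookup j) eq)
lookup-injective (x∉ ∷ _) {suc i} {zero} eq = ⊥-elim (All.lookup x∉ (∈-lookup i) (≡.sym eq))
lookup-injective (_ ∷ uniq) {suc i} {suc j} eq = ≡.cong suc (lookup-injective uniq eq)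

¬¬-decidable : ∀ {m} (P : Fin m → Set) → ¬ ¬ Decidable P
¬¬-decidable {zero} P k = k (λ ())
¬¬-decidable {suc m} P k =
  ¬¬-excluded-middle λ P0? → ¬¬-decidable (P ∘ suc) λ P∘suc? →
  k λ { zero → P0? ; (suc i) → P∘suc? i }

module _ {n : ℕ} where

  open import Data.List.Membership.DecPropositional (_≟_ {n}) using (_∈?_)

  Closed : Rel₂ n → (Fin n → Set) → Set
  Closed E P = ∀ {u v} → E u v ≡ true → P u → P v

  reach-trans : ∀ {E : Rel₂ n} {x y z} → Reach E x y → Reach E y z → Reach E x z
  reach-trans here yz = yz
  reach-trans (step e xy) yz = step e (reach-trans xy yz)

  reach-sym : ∀ {E : Rel₂ n} → (∀ u v → E u v ≡ E v u) → ∀ {x y} → Reach E x y → Reach E y x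
  reach-sym E-sym here = here
  reach-sym E-sym (step {u} {v} e r) = reach-trans (reach-sym E-sym r) (step (trans (E-sym v u) e) here)

  reach-mono : ∀ {E E' : Rel₂ n} → E ⊆ₑ E' → ∀ {x y} → Reach E x y → Reach E' x y
  reach-mono E⊆E' here = here
  reach-mono E⊆E' (step e r) = step (E⊆E' _ _ e) (reach-mono E⊆E' r)

  reach-closed : ∀ {E : Rel₂ n} {P : Fin n → Set} → Closed E P → ∀ {x y} → Reach E x y → P x → P y
  reach-closed closed here px = px
  reach-closed closed (step e r) px = reach-closed closed r (closed e px)

  reach-from-closed : ∀ {E : Rel₂ n} x → Closed E (Reach E x)
  reach-from-closed x e r = reach-trans r (step e here)

  data Walk (E : Rel₂ n) : Fin n → List (Fin n) → Fin n → Set where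
    []  : ∀ {x} → Walk E x [] x
    _∷_ : ∀ {x y ys z} → E x y ≡ true → Walk E y ys z → Walk E x (y ∷ ys) z

  SimplePath : Rel₂ n → Fin n → Fin n → Set
  SimplePath E x z = Σ (List (Fin n)) λ ys → Walk E x ys z × Unique (x ∷ ys)

  walk-map : ∀ {E E' : Rel₂ n} → E ⊆ₑ E' → ∀ {x ys z} → Walk E x ys z → Walk E' x ys z
  walk-map E⊆E' [] = []
  walk-map E⊆E' (e ∷ walk) = E⊆E' _ _ e ∷ walk-map E⊆E' walk

  walk-reach : ∀ {E : Rel₂ n} {x ys z} → Walk E x ys z → All (Reach E x) (x ∷ ys)
  walk-reach [] = here ∷ []
  walk-reach (e ∷ walk) = here ∷ All.map (step e) (walk-reach walk)

  walk-step : ∀ {E : Rel₂ n} {x ys z} → Walk E x ys z → (i : Fin (length ys)) →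
    E (lookup (x ∷ ys) (inject₁ i)) (lookup (x ∷ ys) (suc i)) ≡ true
  walk-step (e ∷ walk) zero = e
  walk-step (e ∷ walk) (suc i) = walk-step walk i

  walk-last : ∀ {E : Rel₂ n} {x ys z} → Walk E x ys z → lookup (x ∷ ys) (fromℕ (length ys)) ≡ z
  walk-last [] = refl
  walk-last (e ∷ walk) = walk-last walk

  simplePath-suffix : ∀ {E : Rel₂ n} {x ys z v} → Walk E x ys z → Unique (x ∷ ys) → v ∈ x ∷ ys →
    SimplePath E v z
  simplePath-suffix walk uniq (here refl) = _ , walk , uniq
  simplePath-suffix (_ ∷ walk) (_ ∷ uniq) (there v∈) = simplePath-suffix walk uniq v∈

  reach⇒simplePath : ∀ {E : Rel₂ n} {x z} → Reach E x z → SimplePath E x z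
  reach⇒simplePath here = [] , [] , [] ∷ []
  reach⇒simplePath {x = x} (step {v = y} e r) with reach⇒simplePath r
  ... | ys , walk , uniq with x ∈? y ∷ ys
  ...   | yes x∈ = simplePath-suffix walk uniq x∈
  ...   | no x∉ = y ∷ ys , e ∷ walk , ¬Any⇒All¬ _ x∉ ∷ uniq

  SameEdge : Fin n → Fin n → Fin n → Fin n → Set
  SameEdge u v x y = (x ≡ u × y ≡ v) ⊎ (x ≡ v × y ≡ u)

  sameEdge? : ∀ u v x y → Dec (SameEdge u v x y)
  sameEdge? u v x y = (x ≟ u ×-dec y ≟ v) ⊎-dec (x ≟ v ×-dec y ≟ u)

  sameEdge-flip : ∀ {u v x y} → SameEdge u v x y → SameEdge u v y x
  sameEdge-flip (inj₁ (x≡u , y≡v)) = inj₂ (y≡v , x≡u)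
  sameEdge-flip (inj₂ (x≡v , y≡u)) = inj₁ (y≡u , x≡v)

  removeEdge : Rel₂ n → Fin n → Fin n → Rel₂ n
  removeEdge F u v x y = F x y ∧ not (does (sameEdge? u v x y))

  removeEdge-⊂ : ∀ {F : Rel₂ n} {u v} → F u v ≡ true → removeEdge F u v ⊂ₑ F
  removeEdge-⊂ {F} {u} {v} Fuv = (λ _ _ → proj₁ ∘ ∧-true⁻) , u , v , Fuv , uv-removed
    where
      uv-removed : removeEdge F u v u v ≡ false
      uv-removed rewrite dec-true (sameEdge? u v u v) (inj₁ (refl , refl)) = ∧-zeroʳ (F u v)

  module _ (G : SimpleGraph n) where

    walk⇒cycle : ∀ {u v y ys w} → Walk (adj G) u (v ∷ y ∷ ys) w → Unique (u ∷ v ∷ y ∷ ys) →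
      adj G w u ≡ true → Cycle G
    walk⇒cycle {u} {v} {y} {ys} walk uniq wu = record
      { k = length ys
      ; c = lookup (u ∷ v ∷ y ∷ ys)
      ; inj = lookup-injective uniq
      ; path = walk-step walk
      ; close = subst (λ t → adj G t u ≡ true) (≡.sym (walk-last walk)) wu
      }

    detour⇒cycle : ∀ {E : Rel₂ n} {u v w} → E ⊆ₑ adj G → adj G u v ≡ true → adj G u w ≡ true → v ≢ w →
      Reach E v w → ¬ Reach E v u → Cycle G
    detour⇒cycle E⊆G uv uw v≢w vw ¬vu with reach⇒simplePath vw
    ... | [] , [] , _ = ⊥-elim (v≢w refl)
    ... | y ∷ ys , walk , uniq =
      walk⇒cycle (uv ∷ walk-map E⊆G walk) (u∉ ∷ uniq) (trans (sym G _ _) uw)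
      where
        u∉ : All (_ ≢_) (_ ∷ y ∷ ys)
        u∉ = All.map (λ vt u≡t → ¬vu (subst (Reach _ _) (≡.sym u≡t) vt)) (walk-reach walk)

    deleteEdges⁺ : ∀ {F : Rel₂ n} {u v} → adj G u v ≡ true → F u v ≡ false → deleteEdges G F u v ≡ true
    deleteEdges⁺ uv Fuv rewrite uv | Fuv = refl

    deleteEdges⁻ : ∀ {F : Rel₂ n} {u v} → deleteEdges G F u v ≡ true →
      adj G u v ≡ true × F u v ≡ false
    deleteEdges⁻ h with ∧-true⁻ h
    ... | uv , ¬Fuv = uv , not-true⁻ ¬Fuv

    deleteEdges⊆adj : ∀ {F : Rel₂ n} → deleteEdges G F ⊆ₑ adj G
    deleteEdges⊆adj {F} _ _ = proj₁ ∘ deleteEdges⁻ {F}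

    deleteEdges-sym : ∀ {F : Rel₂ n} → IsEdgeSet G F →
      ∀ u v → deleteEdges G F u v ≡ deleteEdges G F v u
    deleteEdges-sym (F-sym , _) u v = cong₂ (λ p q → p ∧ not q) (sym G u v) (F-sym u v)

    deleteEdges-antitone : ∀ {F F' : Rel₂ n} → F' ⊆ₑ F → deleteEdges G F ⊆ₑ deleteEdges G F'
    deleteEdges-antitone {F} {F'} F'⊆F u v h with deleteEdges⁻ {F} h
    ... | uv , ¬Fuv = deleteEdges⁺ {F'} uv (true⇒true-contra (F'⊆F u v) ¬Fuv)

    removeEdge-edgeSet : ∀ {F : Rel₂ n} {u v} → IsEdgeSet G F → IsEdgeSet G (removeEdge F u v)
    removeEdge-edgeSet {F} {u} {v} (F-sym , F⊆G) = removed-sym , λ x y → F⊆G x y ∘ proj₁ ∘ ∧-true⁻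
      where
        removed-sym : ∀ x y → removeEdge F u v x y ≡ removeEdge F u v y x
        removed-sym x y = cong₂ (λ p q → p ∧ not q) (F-sym x y)
          (does-⇔ (mk⇔ sameEdge-flip sameEdge-flip) (sameEdge? u v x y) (sameEdge? u v y x))

    deleteEdges-removeEdge : ∀ {F : Rel₂ n} {u v x y} → deleteEdges G (removeEdge F u v) x y ≡ true →
      deleteEdges G F x y ≡ true ⊎ SameEdge u v x y
    deleteEdges-removeEdge {F} {u} {v} {x} {y} h with deleteEdges⁻ {removeEdge F u v} h | sameEdge? u v x y
    ... | _ | yes same = inj₂ same
    ... | xy , removed | no ¬same =
      inj₁ (deleteEdges⁺ {F} xy (∧-not-false⁻ (dec-false (sameEdge? u v x y) ¬same) removed))

    minimalSeparator-sym : ∀ {a b F} → IsMinimalSeparator G a b F → IsMinimalSeparator G b a F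
    minimalSeparator-sym ((F-edgeSet , ¬ab) , minimal) =
      (F-edgeSet , ¬ab ∘ reach-sym (deleteEdges-sym F-edgeSet)) ,
      λ F' F'-edgeSet F'⊂F (_ , ¬ba') →
        minimal F' F'-edgeSet F'⊂F (F'-edgeSet , ¬ba' ∘ reach-sym (deleteEdges-sym F'-edgeSet))

    -- By minimality, G ∖ (F − uv) connects a with b; a predicate closed in G ∖ F that agrees on u
    -- and v is closed there too.
    minimalSeparator-crossing : ∀ {a b F u v} → IsMinimalSeparator G a b F → F u v ≡ true →
      (P : Fin n → Set) → Closed (deleteEdges G F) P → P a → ¬ P b → ¬ (P u ⇔ P v)
    minimalSeparator-crossing {F = F} {u} {v} ((F-edgeSet , _) , minimal) Fuv P closed Pa ¬Pb Pu⇔Pv =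
      minimal _ F'-edgeSet (removeEdge-⊂ Fuv) (F'-edgeSet , λ ab → ¬Pb (reach-closed closed' ab Pa))
      where
        F'-edgeSet : IsEdgeSet G (removeEdge F u v)
        F'-edgeSet = removeEdge-edgeSet F-edgeSet
        closed' : Closed (deleteEdges G (removeEdge F u v)) P
        closed' e with deleteEdges-removeEdge {F} e
        ... | inj₁ e' = closed e'
        ... | inj₂ (inj₁ (refl , refl)) = Equivalence.to Pu⇔Pv
        ... | inj₂ (inj₂ (refl , refl)) = Equivalence.from Pu⇔Pv

    minimalSeparator-¬¬reach : ∀ {a b F u v} → IsMinimalSeparator G a b F → F u v ≡ true →
      ¬ Reach (deleteEdges G F) a u → ¬ ¬ Reach (deleteEdges G F) a v
    minimalSeparator-¬¬reach {a} min Fuv ¬au ¬av =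
      minimalSeparator-crossing min Fuv (Reach _ a) (reach-from-closed a) here (proj₂ (proj₁ min))
        (mk⇔ (⊥-elim ∘ ¬au) (⊥-elim ∘ ¬av))

    acyclic-fork⇒¬¬reach : ∀ {a b F u v w} → Acyclic G → IsMinimalSeparator G a b F →
      F u v ≡ true → F u w ≡ true → v ≢ w → ¬ ¬ Reach (deleteEdges G F) a u
    acyclic-fork⇒¬¬reach {F = F} acyclic min@((F-edgeSet@(_ , F⊆G) , _) , _) Fuv Fuw v≢w ¬au =
      minimalSeparator-¬¬reach min Fuv ¬au λ av →
      minimalSeparator-¬¬reach min Fuw ¬au λ aw →
      acyclic (detour⇒cycle (deleteEdges⊆adj {F}) (F⊆G _ _ Fuv) (F⊆G _ _ Fuw) v≢w
        (reach-trans (reach-sym (deleteEdges-sym F-edgeSet) av) aw)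
        (λ vu → ¬au (reach-trans av vu)))

    acyclic⇒minimalSeparator-matching : ∀ {a b F} → Acyclic G → IsMinimalSeparator G a b F →
      InducesMatching F
    acyclic⇒minimalSeparator-matching acyclic min@((F-edgeSet , ¬ab) , _) u v w Fuv Fuw with v ≟ w
    ... | yes v≡w = v≡w
    ... | no v≢w = ⊥-elim
      (acyclic-fork⇒¬¬reach acyclic min Fuv Fuw v≢w λ au →
       acyclic-fork⇒¬¬reach acyclic (minimalSeparator-sym min) Fuv Fuw v≢w λ bu →
       ¬ab (reach-trans au (reach-sym (deleteEdges-sym F-edgeSet) bu)))

    cut : (Fin n → Bool) → Rel₂ n
    cut C s t = adj G s t ∧ (C s xor C t)

    cut-edgeSet : ∀ C → IsEdgeSet G (cut C)
    cut-edgeSet C = (λ s t → cong₂ _∧_ (sym G s t) (xor-comm (C s) (C t))) , λ _ _ → proj₁ ∘ ∧-true⁻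

    cut⁺ : ∀ {C s t} → adj G s t ≡ true → C s ≡ false → C t ≡ true → cut C s t ≡ true
    cut⁺ st Cs Ct rewrite st | Cs | Ct = refl

    cut-closed : ∀ {C} b → Closed (deleteEdges G (cut C)) (λ t → C t ≡ b)
    cut-closed {C} b e Cs≡b with deleteEdges⁻ {cut C} e
    ... | st , ¬cut = trans (≡.sym (xor≡false⇒≡ (subst (λ z → z ∧ _ ≡ false) st ¬cut))) Cs≡b

    cut-minimalSeparator : ∀ {C x y} → C x ≡ false → C y ≡ true →
      (∀ t → C t ≡ false → Reach (deleteEdges G (cut C)) t x) →
      (∀ t → C t ≡ true → Reach (deleteEdges G (cut C)) t y) →
      IsMinimalSeparator G x y (cut C)
    cut-minimalSeparator {C} {x} {y} Cx Cy toX toY = (cut-edgeSet C , ¬xy) , minimal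
      where
        ¬xy : ¬ Reach (deleteEdges G (cut C)) x y
        ¬xy xy = not-¬ Cy (reach-closed (cut-closed false) xy Cx)

        crossing : ∀ {F' p q} → F' ⊆ₑ cut C → C p ≡ false → C q ≡ true →
          adj G p q ≡ true → F' p q ≡ false → Reach (deleteEdges G F') x y
        crossing {F'} F'⊆cut Cp Cq pq F'pq =
          reach-trans (shrink (reach-sym (deleteEdges-sym (cut-edgeSet C)) (toX _ Cp)))
            (step (deleteEdges⁺ {F'} pq F'pq) (shrink (toY _ Cq)))
          where
            shrink : ∀ {s t} → Reach (deleteEdges G (cut C)) s t → Reach (deleteEdges G F') s t
            shrink = reach-mono (deleteEdges-antitone F'⊆cut)

        minimal : ∀ F' → IsEdgeSet G F' → F' ⊂ₑ cut C → ¬ IsSeparator G x y F'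
        minimal F' (F'-sym , _) (F'⊆cut , p , q , cut-pq , F'pq) (_ , ¬xy') with ∧-true⁻ {adj G p q} cut-pq
        ... | pq , crosses with C p in Cp | C q in Cq
        ... | false | true = ¬xy' (crossing F'⊆cut Cp Cq pq F'pq)
        ... | true | false = ¬xy' (crossing F'⊆cut Cq Cp (trans (sym G q p) pq) (trans (F'-sym q p) F'pq))
        ... | false | false with () ← crosses
        ... | true | true with () ← crosses

    cut-inside : ∀ {C s t b} → C s ≡ b → C t ≡ b → cut C s t ≡ false
    cut-inside {s = s} {t} {b} refl Ct rewrite Ct | xor-same b = ∧-zeroʳ (adj G s t)

    deleteVertex : Fin n → Rel₂ n
    deleteVertex x s t = adj G s t ∧ (not (does (s ≟ x)) ∧ not (does (t ≟ x)))

    deleteVertex⁺ : ∀ {x s t} → adj G s t ≡ true → s ≢ x → t ≢ x → deleteVertex x s t ≡ true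
    deleteVertex⁺ {x} {s} {t} st s≢x t≢x
      rewrite st | dec-false (s ≟ x) s≢x | dec-false (t ≟ x) t≢x = refl

    deleteVertex⁻ : ∀ {x s t} → deleteVertex x s t ≡ true → adj G s t ≡ true × t ≢ x
    deleteVertex⁻ {x} {s} {t} h with ∧-true⁻ {adj G s t} h
    ... | st , off-x =
      st , λ t≡x → not-¬ (dec-true (t ≟ x) t≡x) (not-true⁻ (proj₂ (∧-true⁻ {not (does (s ≟ x))} off-x)))

    deleteVertex-avoids : ∀ {x s t} → Reach (deleteVertex x) s t → s ≢ x → t ≢ x
    deleteVertex-avoids here s≢x = s≢x
    deleteVertex-avoids (step e r) _ = deleteVertex-avoids r (proj₂ (deleteVertex⁻ e))

    cycle-arc : (cyc : Cycle G) → let open Cycle cyc in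
      Reach (deleteVertex (c zero)) (c (suc zero)) (c (fromℕ (suc (suc k))))
    cycle-arc cyc = >-weakInduction (λ i → Reach (deleteVertex (c zero)) (c (suc i)) (c (fromℕ _)))
      here (λ i r → step (deleteVertex⁺ (path (suc i)) (≢c₀ (inject₁ i)) (≢c₀ (suc i))) r) zero
      where
        open Cycle cyc
        ≢c₀ : ∀ i → c (suc i) ≢ c zero
        ≢c₀ i e = 0≢1+n (≡.sym (inj e))

    module ComponentCut (x y : Fin n) (y≢x : y ≢ x)
                        (component? : Decidable (Reach (deleteVertex x) y)) where

      C : Fin n → Bool
      C t = does (component? t)

      C-closed : Closed (deleteVertex x) (λ t → C t ≡ true)
      C-closed e Cs = dec-true (component? _) (reach-from-closed y e (does-true⁻ (component? _) Cs))

      Cx : C x ≡ false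
      Cx = dec-false (component? x) λ yx → deleteVertex-avoids yx y≢x refl

      Cy : C y ≡ true
      Cy = dec-true (component? y) here

      inside : ∀ {s t} → Reach (deleteVertex x) s t → C s ≡ true → Reach (deleteEdges G (cut C)) s t
      inside here _ = here
      inside (step {v = v} e r) Cs = step (deleteEdges⁺ {cut C} (proj₁ (deleteVertex⁻ e)) (cut-inside Cs Cv)) (inside r Cv)
        where
          Cv : C v ≡ true
          Cv = C-closed e Cs

      outside : ∀ {t} → Reach (adj G) t x → C t ≡ false → Reach (deleteEdges G (cut C)) t x
      outside here _ = here
      outside {t} (step {v = s} ts r) Ct with t ≟ x
      ... | yes refl = here
      ... | no t≢x = step (deleteEdges⁺ {cut C} ts (cut-inside Ct Cs)) (outside r Cs)
        where
          Cs : C s ≡ false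
          Cs with s ≟ x
          ... | yes refl = Cx
          ... | no s≢x = true⇒true-contra (C-closed (deleteVertex⁺ (trans (sym G s t) ts) s≢x t≢x)) Ct

      cut-component-minimalSeparator : Connected G → IsMinimalSeparator G x y (cut C)
      cut-component-minimalSeparator connected = cut-minimalSeparator Cx Cy
        (λ t → outside (connected t x))
        (λ t Ct → reach-sym (deleteEdges-sym (cut-edgeSet C)) (inside (does-true⁻ (component? t) Ct) Cy))

    cycle⇒¬minimalSeparators-matching : Connected G → Cycle G →
      ¬ (∀ a b → a ≢ b → ∀ F → IsMinimalSeparator G a b F → InducesMatching F)
    cycle⇒¬minimalSeparators-matching connected cyc matching =
      ¬¬-decidable (Reach (deleteVertex x) y) λ component? →
        let open ComponentCut x y y≢x component? in
        y≢z (matching x y (y≢x ∘ ≡.sym) (cut C) (cut-component-minimalSeparator connected) x y z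
              (cut⁺ {C} (path zero) Cx Cy)
              (cut⁺ {C} (trans (sym G x z) close) Cx (dec-true (component? z) (cycle-arc cyc))))
      where
        open Cycle cyc
        x y z : Fin n
        x = c zero
        y = c (suc zero)
        z = c (fromℕ (suc (suc k)))
        y≢x : y ≢ x
        y≢x e = 0≢1+n (≡.sym (inj e))
        y≢z : y ≢ z
        y≢z e = 0≢1+n (suc-injective (inj e))

theorem3 : ∀ {n : ℕ} (G : SimpleGraph n) → Connected G →
    ((∀ (a b : Fin n) → a ≢ b → ∀ (F : Rel₂ n) → IsMinimalSeparator G a b F → InducesMatching F)
      ⇔ IsTree G)
theorem3 G connected = mk⇔
  (λ matching → connected , λ cyc → cycle⇒¬minimalSeparators-matching G connected cyc matching)
  (λ (_ , acyclic) _ _ _ _ → acyclic⇒minimalSeparator-matching G acyclic)
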